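{- Let $G$ be a finite graph (loops and multiple edges allowed) with $n$ vertices. The polychromate $\chi_G(\mathbf x,y)$ is obtained from the $U$-polynomial $U_G(\mathbf x,y)$ by replacing, for each $\tau\vdash n$ and each $j$, the monomial $\mathbf x_\tau y^j$ by \[\sum_{\tau'\vdash n}a_{\tau,\tau'}\,\mathbf x_{\tau'}\,y^j(y-1)^{n-k(\tau)}.\]
   Context: Let $G$ have vertex set $V$ and edge set $E$. For an integer partition $\tau=(n_1,\ldots,n_k)\vdash n$, $k(\tau)=k$ is its number of parts and $\mathbf x_\tau=x_{n_1}x_{n_2}\cdots x_{n_k}$, where $x_1,x_2,\ldots$ are commuting indeterminates. For $A\subseteq E$, $G|A=(V,A)$, $k(G|A)$ is its number of components and $r(A)=|V|-k(G|A)$. The $U$-polynomial is $U_G(\mathbf x,y)=\sum_{A\subseteq E}x_{n_1}\cdots x_{n_{k(G|A)}}(y-1)^{|A|-r(A)}$, where $n_1,\ldots,n_{k(G|A)}$ are the numbers of vertices of the components of $G|A$ (so every monomial of $U_G$ has the form $\mathbf x_\tau y^j$ with $\tau\vdash n$). The type of a set partition is the integer partition formed by its block sizes. The polychromate is $\chi_G(\mathbf x,y)=\sum_\pi y^{e(\pi)}\mathbf x_{\tau(\pi)}$, summed over all partitions $\pi$ of $V$, where $e(\pi)$ is the number of edges with both endpoints in a common block and $\tau(\pi)$ is the type of $\pi$. For $\tau,\tau'\vdash n$, $a_{\tau,\tau'}$ is the number of coarsenings of type $\tau'$ of a fixed partition of $\{1,\ldots,n\}$ of type $\tau$ (a coarsening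 of $\pi$ is a partition each of whose blocks is a union of blocks of $\pi$); equivalently $p_\tau=\sum_{\tau'}a_{\tau,\tau'}m_{\tau'}$ for the power-sum and augmented monomial symmetric functions. -}

module Defs where

open import Data.Bool using (Bool; true; false; _∧_; _∨_; not; if_then_else_)
open import Data.Nat using (ℕ; zero; suc; _∸_; _<ᵇ_; _≡ᵇ_; _≤_)
open import Data.Nat.Properties using (≤-decTotalOrder; ≤-totalOrder)
open import Data.Fin using (Fin; toℕ)
open import Data.Product using (_×_; _,_)
open import Data.List using (List; []; _∷_; [_]; _++_; map; concatMap; filterᵇ; length; foldr; allFin)
open import Data.Bool.ListAction using (all; any)
open import Data.Nat.ListAction using (sum)
open import Data.List.Properties using (≡-dec)
open import Data.List.Relation.Unary.Sorted.TotalOrder ≤-totalOrder using (Sorted)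
open import Data.List.Relation.Unary.All using (All)
open import Data.List.Sort.InsertionSort ≤-decTotalOrder using (sort)
open import Data.Integer as ℤ using (ℤ)
open import Relation.Binary.PropositionalEquality using (_≡_)
open import Relation.Nullary using (does)
import Data.Nat as ℕ

record Graph : Set where
  field
    n     : ℕ
    edges : List (Fin n × Fin n)
open Graph public

-- Integer partitions: represented canonically as nondecreasing lists of
-- positive parts.  τ ⊢ n :

IntPartition : Set
IntPartition = List ℕ

_⊢_ : IntPartition → ℕ → Set
τ ⊢ n = Sorted τ × All (λ m → 1 ≤ m) τ × sum τ ≡ n

kParts : IntPartition → ℕ
kParts = length

_==ₚ_ : IntPartition → IntPartition → Bool
τ ==ₚ τ' = does (≡-dec ℕ._≟_ τ τ')

-- Set partitions of Fin n, represented (bijectively) by their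
-- equivalence relations, given as Boolean matrices.

BRel : ℕ → Set
BRel n = Fin n → Fin n → Bool

allFuns : {X : Set} → List X → (n : ℕ) → List (Fin n → X)
allFuns xs zero = [ (λ ()) ]
allFuns xs (suc n) =
  concatMap (λ x → map (λ f → λ { Fin.zero → x ; (Fin.suc i) → f i }) (allFuns xs n)) xs

allBRels : (n : ℕ) → List (BRel n)
allBRels n = allFuns (allFuns (false ∷ true ∷ []) n) n

_⇒ᵇ_ : Bool → Bool → Bool
a ⇒ᵇ b = not a ∨ b

isEquivᵇ : {n : ℕ} → BRel n → Bool
isEquivᵇ {n} R =
  all (λ i → R i i) (allFin n) ∧
  all (λ i → all (λ j → R i j ⇒ᵇ R j i) (allFin n)) (allFin n) ∧
  all (λ i → all (λ j → all (λ k → (R i j ∧ R j k) ⇒ᵇ R i k) (allFin n)) (allFin n)) (allFin n)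

setPartitions : (n : ℕ) → List (BRel n)
setPartitions n = filterᵇ isEquivᵇ (allBRels n)

isMinOfBlock : {n : ℕ} → BRel n → Fin n → Bool
isMinOfBlock {n} R i = not (any (λ j → (toℕ j <ᵇ toℕ i) ∧ R i j) (allFin n))

blockSize : {n : ℕ} → BRel n → Fin n → ℕ
blockSize {n} R i = length (filterᵇ (R i) (allFin n))

numBlocks : {n : ℕ} → BRel n → ℕ
numBlocks {n} R = length (filterᵇ (isMinOfBlock R) (allFin n))

type : {n : ℕ} → BRel n → IntPartition
type {n} R = sort (map (blockSize R) (filterᵇ (isMinOfBlock R) (allFin n)))

isCoarseningᵇ : {n : ℕ} → BRel n → BRel n → Bool
isCoarseningᵇ {n} π π' = all (λ i → all (λ j → π i j ⇒ᵇ π' i j) (allFin n)) (allFin n)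

-- a_{τ,τ'} : the fixed partition of {0,…,n-1} of type τ = (n₁,…,n_k)
-- has consecutive blocks of sizes n₁, …, n_k.

blockIndex : IntPartition → ℕ → ℕ
blockIndex []      i = 0
blockIndex (m ∷ τ) i = if i <ᵇ m then 0 else suc (blockIndex τ (i ∸ m))

canonPartition : (n : ℕ) → IntPartition → BRel n
canonPartition n τ i j = blockIndex τ (toℕ i) ≡ᵇ blockIndex τ (toℕ j)

a : (n : ℕ) → IntPartition → IntPartition → ℕ
a n τ τ' = length (filterᵇ (λ π' → isCoarseningᵇ (canonPartition n τ) π' ∧ (type π' ==ₚ τ'))
                           (setPartitions n))

-- all sub(multi)sets A ⊆ E (edges distinguished by position)
subsets : {X : Set} → List X → List (List X)
subsets []       = [ [] ]
subsets (x ∷ xs) = subsets xs ++ map (x ∷_) (subsets xs)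

closeStep : {n : ℕ} → List (Fin n × Fin n) → BRel n → BRel n
closeStep A R i j =
  R i j ∨ any (λ { (u , v) → (R i u ∧ R v j) ∨ (R i v ∧ R u j) }) A

iterate : {X : Set} → ℕ → (X → X) → X → X
iterate zero    f x = x
iterate (suc k) f x = f (iterate k f x)

diagonal : {n : ℕ} → BRel n
diagonal i j = does (i Data.Fin.≟ j)

connected : {n : ℕ} → List (Fin n × Fin n) → BRel n
connected {n} A = iterate n (closeStep A) diagonal

kComp : (G : Graph) → List (Fin (n G) × Fin (n G)) → ℕ
kComp G A = numBlocks (connected A)

rank : (G : Graph) → List (Fin (n G) × Fin (n G)) → ℕ
rank G A = n G ∸ kComp G A

compType : (G : Graph) → List (Fin (n G) × Fin (n G)) → IntPartition
compType G A = type (connected A)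

-- Polynomials in the x's and y whose monomials are x_τ y^j (τ ⊢ n) are
-- represented by their x-coefficients: for each τ, a polynomial in y,
-- given (via evaluation) as a function ℤ → ℤ.  A term list
-- [(τ₁ , f₁) , …] denotes Σ x_{τᵢ} fᵢ(y).

XYTerms : Set
XYTerms = List (IntPartition × (ℤ → ℤ))

coeffX : XYTerms → IntPartition → ℤ → ℤ
coeffX ts τ y = foldr (λ { (σ , f) acc → (if σ ==ₚ τ then f y else ℤ.0ℤ) ℤ.+ acc }) ℤ.0ℤ ts

U : (G : Graph) → XYTerms
U G = map (λ A → compType G A , (λ y → (y ℤ.- ℤ.1ℤ) ℤ.^ (length A ∸ rank G A)))
          (subsets (edges G))

eInside : (G : Graph) → BRel (n G) → ℕ
eInside G π = length (filterᵇ (λ { (u , v) → π u v }) (edges G))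

χ : (G : Graph) → XYTerms
χ G = map (λ π → type π , (λ y → y ℤ.^ eInside G π)) (setPartitions (n G))

-- The substitution Φ_n : x_τ y^j ↦ Σ_{τ'} a_{τ,τ'} x_{τ'} y^j (y-1)^{n-k(τ)},
-- extended ℤ[y]-linearly; we give the x_{τ'}-coefficient of the image.
ΦCoeff : (n : ℕ) → XYTerms → IntPartition → ℤ → ℤ
ΦCoeff n ts τ' y =
  foldr (λ { (τ , f) acc →
          (ℤ.+ a n τ τ') ℤ.* f y ℤ.* ((y ℤ.- ℤ.1ℤ) ℤ.^ (n ∸ kParts τ)) ℤ.+ acc })
        ℤ.0ℤ ts

-- Expanding y^{e(π)} = Σ_{A ⊆ E(π)} (y-1)^{|A|}, with E(π) the edges inside blocks of π, and exchanging
-- the sums turns the x_{τ′}-coefficient of χ_G into Σ_{A ⊆ E} (y-1)^{|A|} N_A, where N_A counts the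
-- partitions of type τ′ having every edge of A inside a block, i.e. the coarsenings of type τ′ of the
-- component partition of G|A. Relabelling the vertices shows that N_A only depends on the type τ(G|A), so
-- N_A = a_{τ(G|A),τ′}; finally (y-1)^{|A|} = (y-1)^{|A|-r(A)} (y-1)^{n-k(G|A)} since r(A) ≤ |A|.
module Submission where

open import Defs
open import Data.Bool using (Bool; true; false; _∧_; _∨_; not; if_then_else_; T; T?)
import Data.Bool.Properties as Bool
open import Data.Bool.Properties using (T-∧; T-∨)
open import Data.Bool.ListAction using (all; any; or)
open import Data.Empty using (⊥; ⊥-elim)
open import Data.Fin as Fin using (Fin; toℕ)
import Data.Fin.Properties as Fin
open import Data.Fin.Permutation using (Permutation′; permutation; _⟨$⟩ʳ_; _⟨$⟩ˡ_; flip; inverseˡ; inverseʳ)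
open import Data.Integer using (ℤ; +_; 0ℤ; 1ℤ; _+_; _-_; _*_; _^_)
import Data.Integer.Properties as ℤ
open import Data.Integer.Tactic.RingSolver using (solve-∀)
open import Data.Nat using (ℕ; zero; suc; _≤_; _<_; _∸_; z≤n; s≤s; _<ᵇ_; _≡ᵇ_)
import Data.Nat as ℕ
import Data.Nat.Properties as ℕ
open import Data.List
  using (List; []; _∷_; [_]; _++_; map; concat; concatMap; cartesianProductWith; filter; filterᵇ; length; allFin; lookup)
import Data.List.Properties as List
open import Data.List.Membership.Propositional using (_∈_; find; lose)
open import Data.List.Membership.Propositional.Properties
  using ( ∈-allFin; ∈-filter⁺; ∈-filter⁻; ∈-map⁺; ∈-map⁻; ∈-++⁺ˡ; ∈-++⁺ʳ; ∈-++⁻; ∈-concat⁺′; ∈-concat⁻′; ∈-∃++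
        ; ∈-cartesianProductWith⁺)
import Data.List.Membership.DecPropositional as DecMembership
open import Data.List.Membership.Propositional.Properties.WithK using (unique∧set⇒bag)
open import Data.List.Relation.Binary.BagAndSetEquality using (∼bag⇒↭)
open import Data.List.Relation.Binary.Permutation.Propositional using (_↭_; ↭-sym; ↭-trans; prep; swap; ↭⇒↭ₛ)
import Data.List.Relation.Binary.Permutation.Propositional as Perm
import Data.List.Relation.Binary.Permutation.Propositional.Properties as ↭
import Data.List.Relation.Binary.Permutation.Setoid.Properties as SetoidPerm
import Data.List.Relation.Binary.Pointwise as Pointwise
import Data.List.Relation.Unary.All as All
open import Data.List.Relation.Unary.All.Properties using (all⁺; all⁻)
open import Data.List.Relation.Unary.Any as Any using (here; there)
import Data.List.Relation.Unary.Any.Properties as Any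
open import Data.List.Relation.Unary.Any.Properties using (any⁺; any⁻)
open import Data.List.Relation.Unary.Sorted.TotalOrder.Properties using (↗↭↗⇒≋)
open import Data.List.Relation.Unary.Unique.Propositional using (Unique; []; _∷_)
import Data.List.Relation.Unary.Unique.Propositional.Properties as Unique
open import Data.List.Sort.InsertionSort ℕ.≤-decTotalOrder using (sort; insert)
import Data.List.Sort.InsertionSort.Properties ℕ.≤-decTotalOrder as Sort
open import Data.Product using (_×_; _,_; proj₁; proj₂; ∃-syntax)
open import Data.Sum using (_⊎_; inj₁; inj₂)
open import Data.Vec as Vec using (Vec)
import Data.Vec.Properties as Vec
open import Function using (_∘_; id; mk⇔; Equivalence)
open import Relation.Binary using (tri<; tri≈; tri>)
open import Relation.Binary.PropositionalEquality
  using (_≡_; _≢_; refl; sym; trans; cong; cong₂; subst; setoid; module ≡-Reasoning)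
open import Relation.Nullary using (¬_; yes; no; does)

∧-intro : ∀ {x y} → T x → T y → T (x ∧ y)
∧-intro tx ty = Equivalence.from T-∧ (tx , ty)

∧-elimˡ : ∀ {x y} → T (x ∧ y) → T x
∧-elimˡ {x} {y} = proj₁ ∘ Equivalence.to (T-∧ {x} {y})

∧-elimʳ : ∀ {x y} → T (x ∧ y) → T y
∧-elimʳ {x} {y} = proj₂ ∘ Equivalence.to (T-∧ {x} {y})

∨-elim : ∀ {x y} → T (x ∨ y) → T x ⊎ T y
∨-elim {x} {y} = Equivalence.to (T-∨ {x} {y})

∨-introˡ : ∀ {x y} → T x → T (x ∨ y)
∨-introˡ {x} {y} = Equivalence.from (T-∨ {x} {y}) ∘ inj₁

∨-introʳ : ∀ {x y} → T y → T (x ∨ y)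
∨-introʳ {x} {y} = Equivalence.from (T-∨ {x} {y}) ∘ inj₂

⇒ᵇ-intro : ∀ {x y} → (T x → T y) → T (x ⇒ᵇ y)
⇒ᵇ-intro {true}  f = f _
⇒ᵇ-intro {false} f = _

⇒ᵇ-elim : ∀ {x y} → T (x ⇒ᵇ y) → T x → T y
⇒ᵇ-elim {true} ty _ = ty

not-intro : ∀ {x} → ¬ T x → T (not x)
not-intro {true}  ¬tx = ¬tx _
not-intro {false} _   = _

not-elim : ∀ {x} → T (not x) → ¬ T x
not-elim {true} ()

¬not⇒T : ∀ {x} → ¬ T (not x) → T x
¬not⇒T {true}  _      = _
¬not⇒T {false} ¬tnotx = ⊥-elim (¬tnotx _)

T-ext : ∀ {x y} → (T x → T y) → (T y → T x) → x ≡ y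
T-ext {true}  {true}  _ _ = refl
T-ext {true}  {false} f _ = ⊥-elim (f _)
T-ext {false} {true}  _ g = ⊥-elim (g _)
T-ext {false} {false} _ _ = refl

module _ {A : Set} (p : A → Bool) where
  any-∈⁻ : ∀ xs → T (any p xs) → ∃[ x ] x ∈ xs × T (p x)
  any-∈⁻ xs = find ∘ any⁻ p xs

  any-∈⁺ : ∀ {xs x} → x ∈ xs → T (p x) → T (any p xs)
  any-∈⁺ x∈xs px = any⁺ p (lose x∈xs px)

module _ {n : ℕ} (p : Fin n → Bool) where
  all-allFin⁻ : T (all p (allFin n)) → ∀ i → T (p i)
  all-allFin⁻ h i = All.lookup (all⁺ p (allFin n) h) (∈-allFin i)

  all-allFin⁺ : (∀ i → T (p i)) → T (all p (allFin n))
  all-allFin⁺ h = all⁻ p {allFin n} (All.tabulate (λ {i} _ → h i))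

  ∈-filterᵇ-allFin⁺ : ∀ {i} → T (p i) → i ∈ filterᵇ p (allFin n)
  ∈-filterᵇ-allFin⁺ {i} = ∈-filter⁺ (T? ∘ p) (∈-allFin i)

  ∈-filterᵇ-allFin⁻ : ∀ {i} → i ∈ filterᵇ p (allFin n) → T (p i)
  ∈-filterᵇ-allFin⁻ = proj₂ ∘ ∈-filter⁻ (T? ∘ p) {xs = allFin n}

∧-cong-T : ∀ {x x′ y y′} → x ≡ x′ → (T x′ → y ≡ y′) → x ∧ y ≡ x′ ∧ y′
∧-cong-T {x′ = false} refl _     = refl
∧-cong-T {x′ = true}  refl y≡y′ = cong (true ∧_) (y≡y′ _)

module _ {A : Set} where
  count : (A → Bool) → List A → ℕ
  count p xs = length (filterᵇ p xs)

  filterᵇ-cong : ∀ {p q : A → Bool} → (∀ x → p x ≡ q x) → ∀ xs → filterᵇ p xs ≡ filterᵇ q xs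
  filterᵇ-cong {p} {q} p≗q []       = refl
  filterᵇ-cong {p} {q} p≗q (x ∷ xs) with p x | q x | p≗q x
  ... | true  | true  | refl = cong (x ∷_) (filterᵇ-cong p≗q xs)
  ... | false | false | refl = filterᵇ-cong p≗q xs

  count-cong : ∀ {p q : A → Bool} → (∀ x → p x ≡ q x) → ∀ xs → count p xs ≡ count q xs
  count-cong p≗q = cong length ∘ filterᵇ-cong p≗q

  count-↭ : ∀ (p : A → Bool) {xs ys} → xs ↭ ys → count p xs ≡ count p ys
  count-↭ p = ↭.↭-length ∘ ↭.filter-↭ (T? ∘ p)

  count-filterᵇ : ∀ (p q : A → Bool) xs → count q (filterᵇ p xs) ≡ count (λ x → p x ∧ q x) xs
  count-filterᵇ p q []       = refl
  count-filterᵇ p q (x ∷ xs) with p x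
  ... | false = count-filterᵇ p q xs
  ... | true with q x
  ...   | true  = cong suc (count-filterᵇ p q xs)
  ...   | false = count-filterᵇ p q xs

count-map : ∀ {A B : Set} (p : B → Bool) (f : A → B) xs → count p (map f xs) ≡ count (p ∘ f) xs
count-map p f []       = refl
count-map p f (x ∷ xs) with p (f x)
... | true  = cong suc (count-map p f xs)
... | false = count-map p f xs

module _ {X : Set} (p q : X → Bool) where
  count-mono : ∀ xs → (∀ {x} → x ∈ xs → T (p x) → T (q x)) → count p xs ≤ count q xs
  count-mono []       _   = z≤n
  count-mono (x ∷ xs) p⇒q with p x in px | q x in qx
  ... | true  | true  = s≤s (count-mono xs (p⇒q ∘ there))
  ... | true  | false = ⊥-elim (subst T qx (p⇒q (here refl) (subst T (sym px) _)))
  ... | false | true  = ℕ.m≤n⇒m≤1+n (count-mono xs (p⇒q ∘ there))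
  ... | false | false = count-mono xs (p⇒q ∘ there)

  count≤suc-count : ∀ xs → Unique xs →
                    (∀ {x y} → x ∈ xs → y ∈ xs → T (p x) → ¬ T (q x) → T (p y) → ¬ T (q y) → x ≡ y) →
                    count p xs ≤ suc (count q xs)
  count≤suc-count []       _          _    = z≤n
  count≤suc-count (x ∷ xs) (x∉ ∷ xs!) once with p x in px | q x in qx
  ... | true  | true  = s≤s (count≤suc-count xs xs! λ x∈ y∈ → once (there x∈) (there y∈))
  ... | false | true  = ℕ.m≤n⇒m≤1+n (count≤suc-count xs xs! λ x∈ y∈ → once (there x∈) (there y∈))
  ... | false | false = count≤suc-count xs xs! λ x∈ y∈ → once (there x∈) (there y∈)
  ... | true  | false = s≤s (count-mono xs p⇒q)
    where
      p⇒q : ∀ {y} → y ∈ xs → T (p y) → T (q y)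
      p⇒q {y} y∈xs py with T? (q y)
      ... | yes qy = qy
      ... | no ¬qy = ⊥-elim (All.lookup x∉ y∈xs
                       (once (here refl) (there y∈xs) (subst T (sym px) _) (subst T qx) py ¬qy))

module _ {A : Set} where
  Unique-++⁻ˡ : ∀ xs {ys : List A} → Unique (xs ++ ys) → Unique xs
  Unique-++⁻ˡ []       _        = []
  Unique-++⁻ˡ (x ∷ xs) (x∉ ∷ u) = All.tabulate (All.lookup x∉ ∘ ∈-++⁺ˡ) ∷ Unique-++⁻ˡ xs u

  Unique-++⁻ʳ : ∀ xs {ys : List A} → Unique (xs ++ ys) → Unique ys
  Unique-++⁻ʳ []       u       = u
  Unique-++⁻ʳ (x ∷ xs) (_ ∷ u) = Unique-++⁻ʳ xs u

  Unique-++-disjoint : ∀ xs {ys : List A} → Unique (xs ++ ys) → ∀ {v} → v ∈ xs → ¬ v ∈ ys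
  Unique-++-disjoint (x ∷ xs) (x∉ ∷ u) (here refl) v∈ys = All.lookup x∉ (∈-++⁺ʳ xs v∈ys) refl
  Unique-++-disjoint (x ∷ xs) (_ ∷ u)  (there v∈xs) = Unique-++-disjoint xs u v∈xs

  Unique-↭ : ∀ {xs ys : List A} → xs ↭ ys → Unique xs → Unique ys
  Unique-↭ = SetoidPerm.Unique-resp-↭ (setoid A) ∘ ↭⇒↭ₛ

  concat-↭ : ∀ {xss yss : List (List A)} → xss ↭ yss → concat xss ↭ concat yss
  concat-↭ Perm.refl        = Perm.refl
  concat-↭ (prep xs p)      = ↭.++⁺ˡ xs (concat-↭ p)
  concat-↭ (swap xs ys p)   = ↭-trans (↭.++⁺ˡ xs (↭.++⁺ˡ ys (concat-↭ p))) (↭.shifts xs ys)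
  concat-↭ (Perm.trans p q) = ↭-trans (concat-↭ p) (concat-↭ q)

  Unique-same-elements-↭ : ∀ {xs ys : List A} → Unique xs → Unique ys →
                           (∀ {x} → x ∈ xs → x ∈ ys) → (∀ {x} → x ∈ ys → x ∈ xs) → xs ↭ ys
  Unique-same-elements-↭ xs! ys! xs⊆ys ys⊆xs = ∼bag⇒↭ (unique∧set⇒bag xs! ys! (mk⇔ xs⊆ys ys⊆xs))

Unique-concatMap : ∀ {A B : Set} (f : A → List B) {xs} → Unique xs → (∀ {x} → x ∈ xs → Unique (f x)) →
                   (∀ {x y} → x ∈ xs → y ∈ xs → x ≢ y → ∀ {v} → v ∈ f x → ¬ v ∈ f y) →
                   Unique (concat (map f xs))
Unique-concatMap f {[]}     _        _       _        = []
Unique-concatMap f {x ∷ xs} (x∉ ∷ u) unique disjoint =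
  Unique.++⁺ (unique (here refl))
             (Unique-concatMap f u (unique ∘ there) (λ x∈ y∈ → disjoint (there x∈) (there y∈)))
             λ (v∈fx , v∈rest) → disjoint-rest v∈fx v∈rest
  where
    disjoint-rest : ∀ {v} → v ∈ f x → ¬ v ∈ concat (map f xs)
    disjoint-rest v∈fx v∈rest with ∈-concat⁻′ (map f xs) v∈rest
    ... | _ , v∈fy , fy∈ with ∈-map⁻ f fy∈
    ... | y , y∈xs , refl = disjoint (here refl) (there y∈xs) (All.lookup x∉ y∈xs) v∈fx v∈fy

module _ {X : Set} {xs : List X} (unique : Unique xs) (complete : ∀ x → x ∈ xs) where
  map-inverse-↭ : (h g : X → X) → (∀ x → g (h x) ≡ x) → (∀ x → h (g x) ≡ x) → map h xs ↭ xs
  map-inverse-↭ h g g∘h h∘g = ∼bag⇒↭ (unique∧set⇒bag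
    (Unique.map⁺ (λ {x} {y} hx≡hy → trans (sym (g∘h x)) (trans (cong g hx≡hy) (g∘h y))) unique)
    unique
    (λ {x} → mk⇔ (λ _ → complete x) (λ _ → subst (_∈ map h xs) (h∘g x) (∈-map⁺ h (complete (g x))))))

sort-↭ : ∀ {xs ys} → xs ↭ ys → sort xs ≡ sort ys
sort-↭ {xs} {ys} xs↭ys = Pointwise.Pointwise-≡⇒≡
  (↗↭↗⇒≋ ℕ.≤-totalOrder (Sort.sort-↗ xs) (Sort.sort-↗ ys)
         (↭⇒↭ₛ (↭-trans (Sort.sort-↭ xs) (↭-trans xs↭ys (↭-sym (Sort.sort-↭ ys))))))

-- Set partitions of Fin n as Boolean relations

module _ {n : ℕ} where
  _≐_ : BRel n → BRel n → Set
  R ≐ S = ∀ i j → R i j ≡ S i j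

  ≐-sym : ∀ {R S} → R ≐ S → S ≐ R
  ≐-sym R≐S i j = sym (R≐S i j)

  T-resp-≐ : ∀ {R S} → R ≐ S → ∀ {i j} → T (R i j) → T (S i j)
  T-resp-≐ R≐S {i} {j} = subst T (R≐S i j)

  relabel : Permutation′ n → BRel n → BRel n
  relabel ρ R i j = R (ρ ⟨$⟩ʳ i) (ρ ⟨$⟩ʳ j)

  relabel-flip : (ρ : Permutation′ n) (R : BRel n) → relabel (flip ρ) (relabel ρ R) ≐ R
  relabel-flip ρ R i j = cong₂ R (inverseʳ ρ) (inverseʳ ρ)

  record IsPartition (R : BRel n) : Set where
    field
      reflexive  : ∀ i → T (R i i)
      symmetric  : ∀ i j → T (R i j) → T (R j i)
      transitive : ∀ i j k → T (R i j) → T (R j k) → T (R i k)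

  isEquivᵇ-sound : (R : BRel n) → T (isEquivᵇ R) → IsPartition R
  isEquivᵇ-sound R h = record
    { reflexive  = all-allFin⁻ _ (∧-elimˡ h)
    ; symmetric  = λ i j → ⇒ᵇ-elim (all-allFin⁻ _ (all-allFin⁻ _ symᵇ i) j)
    ; transitive = λ i j k rij rjk →
        ⇒ᵇ-elim (all-allFin⁻ _ (all-allFin⁻ _ (all-allFin⁻ _ transᵇ i) j) k) (∧-intro rij rjk)
    }
    where
      symᵇ   = ∧-elimˡ (∧-elimʳ {all (λ i → R i i) (allFin n)} h)
      transᵇ = ∧-elimʳ (∧-elimʳ {all (λ i → R i i) (allFin n)} h)

  isEquivᵇ-complete : (R : BRel n) → IsPartition R → T (isEquivᵇ R)
  isEquivᵇ-complete R isP = ∧-intro (all-allFin⁺ _ reflexive) (∧-intro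
    (all-allFin⁺ _ λ i → all-allFin⁺ _ λ j → ⇒ᵇ-intro (symmetric i j))
    (all-allFin⁺ _ λ i → all-allFin⁺ _ λ j → all-allFin⁺ _ λ k →
       ⇒ᵇ-intro (λ h → transitive i j k (∧-elimˡ h) (∧-elimʳ {R i j} h))))
    where open IsPartition isP

  IsPartition-resp-≐ : ∀ {R S} → R ≐ S → IsPartition R → IsPartition S
  IsPartition-resp-≐ R≐S isP = record
    { reflexive  = λ i → to (reflexive i)
    ; symmetric  = λ i j h → to (symmetric i j (from h))
    ; transitive = λ i j k h h′ → to (transitive i j k (from h) (from h′))
    }
    where
      open IsPartition isP
      to   = T-resp-≐ R≐S
      from = T-resp-≐ (≐-sym R≐S)

  IsPartition-relabel : ∀ ρ {R} → IsPartition R → IsPartition (relabel ρ R)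
  IsPartition-relabel ρ isP = record
    { reflexive  = λ i → reflexive (ρ ⟨$⟩ʳ i)
    ; symmetric  = λ i j → symmetric (ρ ⟨$⟩ʳ i) (ρ ⟨$⟩ʳ j)
    ; transitive = λ i j k → transitive (ρ ⟨$⟩ʳ i) (ρ ⟨$⟩ʳ j) (ρ ⟨$⟩ʳ k)
    }
    where open IsPartition isP

  isEquivᵇ-resp-≐ : ∀ {R S} → R ≐ S → isEquivᵇ R ≡ isEquivᵇ S
  isEquivᵇ-resp-≐ {R} {S} R≐S = T-ext
    (isEquivᵇ-complete S ∘ IsPartition-resp-≐ R≐S ∘ isEquivᵇ-sound R)
    (isEquivᵇ-complete R ∘ IsPartition-resp-≐ (≐-sym R≐S) ∘ isEquivᵇ-sound S)

  isEquivᵇ-relabel : ∀ ρ R → isEquivᵇ (relabel ρ R) ≡ isEquivᵇ R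
  isEquivᵇ-relabel ρ R = T-ext
    (isEquivᵇ-complete R ∘ IsPartition-resp-≐ (relabel-flip ρ R) ∘ IsPartition-relabel (flip ρ)
                         ∘ isEquivᵇ-sound (relabel ρ R))
    (isEquivᵇ-complete (relabel ρ R) ∘ IsPartition-relabel ρ ∘ isEquivᵇ-sound R)

  _⊑_ : BRel n → BRel n → Set
  R ⊑ π = ∀ i j → T (R i j) → T (π i j)

  isCoarseningᵇ-sound : ∀ R π → T (isCoarseningᵇ R π) → R ⊑ π
  isCoarseningᵇ-sound R π h i j = ⇒ᵇ-elim (all-allFin⁻ _ (all-allFin⁻ _ h i) j)

  isCoarseningᵇ-complete : ∀ R π → R ⊑ π → T (isCoarseningᵇ R π)
  isCoarseningᵇ-complete R π R⊑π = all-allFin⁺ _ λ i → all-allFin⁺ _ λ j → ⇒ᵇ-intro (R⊑π i j)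

  isCoarseningᵇ-resp-≐ : ∀ {R R′ π π′} → R ≐ R′ → π ≐ π′ →
                         isCoarseningᵇ R π ≡ isCoarseningᵇ R′ π′
  isCoarseningᵇ-resp-≐ {R} {R′} {π} {π′} R≐R′ π≐π′ = T-ext
    (λ h → isCoarseningᵇ-complete R′ π′ λ i j →
       T-resp-≐ π≐π′ ∘ isCoarseningᵇ-sound R π h i j ∘ T-resp-≐ (≐-sym R≐R′))
    (λ h → isCoarseningᵇ-complete R π λ i j →
       T-resp-≐ (≐-sym π≐π′) ∘ isCoarseningᵇ-sound R′ π′ h i j ∘ T-resp-≐ R≐R′)

  isCoarseningᵇ-relabel : ∀ ρ R π → isCoarseningᵇ (relabel ρ R) (relabel ρ π) ≡ isCoarseningᵇ R π
  isCoarseningᵇ-relabel ρ R π = T-ext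
    (λ h → isCoarseningᵇ-complete R π λ i j →
       T-resp-≐ (relabel-flip ρ π)
         ∘ isCoarseningᵇ-sound (relabel ρ R) (relabel ρ π) h (flip ρ ⟨$⟩ʳ i) (flip ρ ⟨$⟩ʳ j)
         ∘ T-resp-≐ (≐-sym (relabel-flip ρ R)))
    (λ h → isCoarseningᵇ-complete (relabel ρ R) (relabel ρ π) λ i j →
       isCoarseningᵇ-sound R π h (ρ ⟨$⟩ʳ i) (ρ ⟨$⟩ʳ j))

  isMinOfBlock⇒¬related : (R : BRel n) → ∀ {i j} → T (isMinOfBlock R i) → toℕ j < toℕ i → ¬ T (R i j)
  isMinOfBlock⇒¬related R {i} {j} isMin j<i rij =
    not-elim isMin (any-∈⁺ (λ j → (toℕ j <ᵇ toℕ i) ∧ R i j) (∈-allFin j) (∧-intro (ℕ.<⇒<ᵇ j<i) rij))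

  ¬isMinOfBlock⇒related : (R : BRel n) → ∀ {i} → ¬ T (isMinOfBlock R i) → ∃[ j ] toℕ j < toℕ i × T (R i j)
  ¬isMinOfBlock⇒related R {i} ¬isMin
    with any-∈⁻ (λ j → (toℕ j <ᵇ toℕ i) ∧ R i j) (allFin n) (¬not⇒T ¬isMin)
  ... | j , _ , h = j , ℕ.<ᵇ⇒< (toℕ j) (toℕ i) (∧-elimˡ h) , ∧-elimʳ {toℕ j <ᵇ toℕ i} h

  blockMin : (R : BRel n) → IsPartition R → ∀ i → ∃[ m ] T (R i m) × T (isMinOfBlock R m)
  blockMin R isP i = descend (suc (toℕ i)) i ℕ.≤-refl (reflexive i)
    where
      open IsPartition isP
      descend : ∀ fuel j → toℕ j < fuel → T (R i j) → ∃[ m ] T (R i m) × T (isMinOfBlock R m)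
      descend (suc fuel) j (s≤s j≤fuel) rij with T? (isMinOfBlock R j)
      ... | yes isMin = j , rij , isMin
      ... | no ¬isMin with ¬isMinOfBlock⇒related R ¬isMin
      ...   | k , k<j , rjk = descend fuel k (ℕ.<-≤-trans k<j j≤fuel) (transitive i j k rij rjk)

  blockMin-unique : (R : BRel n) → IsPartition R → ∀ {m m′} →
                    T (isMinOfBlock R m) → T (isMinOfBlock R m′) → T (R m m′) → m ≡ m′
  blockMin-unique R isP {m} {m′} isMin isMin′ rmm′ with ℕ.<-cmp (toℕ m) (toℕ m′)
  ... | tri< m<m′ _ _ = ⊥-elim (isMinOfBlock⇒¬related R isMin′ m<m′ (IsPartition.symmetric isP m m′ rmm′))
  ... | tri≈ _ m≡m′ _ = Fin.toℕ-injective m≡m′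
  ... | tri> _ _ m′<m = ⊥-elim (isMinOfBlock⇒¬related R isMin m′<m rmm′)

-- Counting relations up to relabelling

module _ {C : Set} where
  allVecs : List C → (n : ℕ) → List (Vec C n)
  allVecs cs zero    = [ Vec.[] ]
  allVecs cs (suc n) = cartesianProductWith Vec._∷_ cs (allVecs cs n)

  allVecs-unique : ∀ {cs} → Unique cs → ∀ n → Unique (allVecs cs n)
  allVecs-unique cs! zero    = All.[] ∷ []
  allVecs-unique cs! (suc n) = Unique.cartesianProductWith⁺ Vec._∷_ Vec.∷-injective cs! (allVecs-unique cs! n)

  allVecs-complete : ∀ {cs} → (∀ c → c ∈ cs) → ∀ {n} (v : Vec C n) → v ∈ allVecs cs n
  allVecs-complete cs-complete Vec.[]       = here refl
  allVecs-complete cs-complete (c Vec.∷ v) =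
    ∈-cartesianProductWith⁺ Vec._∷_ (cs-complete c) (allVecs-complete cs-complete v)

module _ {X C : Set} (encode : X → C) where
  tabulateWith : ∀ {n} → (Fin n → X) → Vec C n
  tabulateWith f = Vec.tabulate (encode ∘ f)

  map-tabulateWith-allFuns : ∀ xs n → map tabulateWith (allFuns xs n) ≡ allVecs (map encode xs) n
  map-tabulateWith-allFuns xs zero    = refl
  map-tabulateWith-allFuns xs (suc n) = concatMap-extend _ (λ _ _ → refl) xs
    where
      open ≡-Reasoning
      F = allFuns xs n
      -- Abstracted over extend, since the extended lambda inside allFuns cannot be named here.
      concatMap-extend : (extend : X → (Fin n → X) → Fin (suc n) → X) →
           (∀ x f → tabulateWith (extend x f) ≡ encode x Vec.∷ tabulateWith f) →
           ∀ ys → map tabulateWith (concatMap (λ x → map (extend x) F) ys)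
                  ≡ cartesianProductWith Vec._∷_ (map encode ys) (allVecs (map encode xs) n)
      concatMap-extend extend tabulate-extend []       = refl
      concatMap-extend extend tabulate-extend (y ∷ ys) = begin
        map tabulateWith (map (extend y) F ++ rest)
          ≡⟨ List.map-++ tabulateWith (map (extend y) F) rest ⟩
        map tabulateWith (map (extend y) F) ++ map tabulateWith rest
          ≡⟨ cong₂ _++_ (sym (List.map-∘ F)) (concatMap-extend extend tabulate-extend ys) ⟩
        map (tabulateWith ∘ extend y) F ++ _
          ≡⟨ cong (_++ _) (List.map-cong (tabulate-extend y) F) ⟩
        map ((encode y Vec.∷_) ∘ tabulateWith) F ++ _
          ≡⟨ cong (_++ _) (trans (List.map-∘ F) (cong (map (encode y Vec.∷_)) (map-tabulateWith-allFuns xs n))) ⟩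
        map (encode y Vec.∷_) (allVecs (map encode xs) n) ++ _ ∎
        where rest = concatMap (λ x → map (extend x) F) ys

Extensional : ∀ {n} → (BRel n → Bool) → Set
Extensional P = ∀ {R S} → R ≐ S → P R ≡ P S

-- A relabelling does not permute the list allBRels n up to _≡_, its entries being functions, but it does
-- permute the list of their tabulations.
module _ {n : ℕ} where
  private
    bools : List Bool
    bools = false ∷ true ∷ []

  Code : Set
  Code = Vec (Vec Bool n) n

  encode : BRel n → Code
  encode = tabulateWith (tabulateWith id)

  decode : Code → BRel n
  decode c i j = Vec.lookup (Vec.lookup c i) j

  allCodes : List Code
  allCodes = allVecs (allVecs bools n) n

  allCodes-unique : Unique allCodes
  allCodes-unique = allVecs-unique (allVecs-unique (((λ ()) All.∷ All.[]) ∷ All.[] ∷ []) n) n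

  allCodes-complete : ∀ c → c ∈ allCodes
  allCodes-complete = allVecs-complete (allVecs-complete λ { false → here refl ; true → there (here refl) })

  map-encode-allBRels : map encode (allBRels n) ≡ allCodes
  map-encode-allBRels = trans (map-tabulateWith-allFuns (tabulateWith id) (allFuns bools n) n)
                              (cong (λ cs → allVecs cs n) (map-tabulateWith-allFuns id bools n))

  decode-encode : ∀ R → decode (encode R) ≐ R
  decode-encode R i j = trans (cong (λ row → Vec.lookup row j) (Vec.lookup∘tabulate _ i)) (Vec.lookup∘tabulate _ j)

  encode-decode : ∀ c → encode (decode c) ≡ c
  encode-decode c = trans (Vec.tabulate-cong (λ i → Vec.tabulate∘lookup (Vec.lookup c i))) (Vec.tabulate∘lookup c)

  encode-cong : ∀ {R S} → R ≐ S → encode R ≡ encode S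
  encode-cong R≐S = Vec.tabulate-cong λ i → Vec.tabulate-cong λ j → R≐S i j

  count-allBRels-decode : ∀ P → Extensional P → count P (allBRels n) ≡ count (P ∘ decode) allCodes
  count-allBRels-decode P P-ext = begin
    count P (allBRels n)                    ≡⟨ count-cong (λ R → P-ext (≐-sym (decode-encode R))) (allBRels n) ⟩
    count (P ∘ decode ∘ encode) (allBRels n) ≡⟨ count-map (P ∘ decode) encode (allBRels n) ⟨
    count (P ∘ decode) (map encode (allBRels n)) ≡⟨ cong (count (P ∘ decode)) map-encode-allBRels ⟩
    count (P ∘ decode) allCodes ∎
    where open ≡-Reasoning

  encodeRelabel : Permutation′ n → Code → Code
  encodeRelabel ρ = encode ∘ relabel ρ ∘ decode

  encodeRelabel-flip : ∀ ρ c → encodeRelabel (flip ρ) (encodeRelabel ρ c) ≡ c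
  encodeRelabel-flip ρ c = trans
    (encode-cong λ i j → trans (decode-encode (relabel ρ (decode c)) _ _) (relabel-flip ρ (decode c) i j))
    (encode-decode c)

  count-allBRels-relabel : ∀ ρ P → Extensional P → count (P ∘ relabel ρ) (allBRels n) ≡ count P (allBRels n)
  count-allBRels-relabel ρ P P-ext = begin
    count (P ∘ relabel ρ) (allBRels n)
      ≡⟨ count-allBRels-decode (P ∘ relabel ρ) (λ R≐S → P-ext (λ i j → R≐S _ _)) ⟩
    count (P ∘ relabel ρ ∘ decode) allCodes
      ≡⟨ count-cong (λ c → P-ext (≐-sym (decode-encode (relabel ρ (decode c))))) allCodes ⟩
    count (P ∘ decode ∘ encodeRelabel ρ) allCodes
      ≡⟨ count-map (P ∘ decode) (encodeRelabel ρ) allCodes ⟨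
    count (P ∘ decode) (map (encodeRelabel ρ) allCodes)
      ≡⟨ count-↭ (P ∘ decode) (map-inverse-↭ allCodes-unique allCodes-complete
           (encodeRelabel ρ) (encodeRelabel (flip ρ)) (encodeRelabel-flip ρ) (encodeRelabel-flip (flip ρ))) ⟩
    count (P ∘ decode) allCodes
      ≡⟨ count-allBRels-decode P P-ext ⟨
    count P (allBRels n) ∎
    where open ≡-Reasoning

-- Block lists and the type of a partition

module _ {n : ℕ} where
  record IsBlockList (R : BRel n) (Bs : List (List (Fin n))) : Set where
    field
      unique   : Unique (concat Bs)
      nonEmpty : ∀ {B} → B ∈ Bs → ∃[ x ] x ∈ B
      related  : ∀ {B} → B ∈ Bs → ∀ {x y} → x ∈ B → y ∈ B → T (R x y)
      closed   : ∀ {B} → B ∈ Bs → ∀ {x y} → x ∈ B → y ∈ concat Bs → T (R x y) → y ∈ B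

  IsBlockList-↭ : ∀ {R Bs Cs} → Bs ↭ Cs → IsBlockList R Bs → IsBlockList R Cs
  IsBlockList-↭ Bs↭Cs isBL = record
    { unique   = Unique-↭ (concat-↭ Bs↭Cs) unique
    ; nonEmpty = λ B∈ → nonEmpty (back B∈)
    ; related  = λ B∈ → related (back B∈)
    ; closed   = λ B∈ x∈ y∈ → closed (back B∈) x∈ (↭.∈-resp-↭ (concat-↭ (↭-sym Bs↭Cs)) y∈)
    }
    where
      open IsBlockList isBL
      back : ∀ {B} → B ∈ _ → B ∈ _
      back = ↭.∈-resp-↭ (↭-sym Bs↭Cs)

  IsBlockList-tail : ∀ {R B Bs} → IsBlockList R (B ∷ Bs) → IsBlockList R Bs
  IsBlockList-tail {B = B} isBL = record
    { unique   = Unique-++⁻ʳ B unique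
    ; nonEmpty = λ B∈ → nonEmpty (there B∈)
    ; related  = λ B∈ → related (there B∈)
    ; closed   = λ B∈ x∈ y∈ → closed (there B∈) x∈ (∈-++⁺ʳ B y∈)
    }
    where open IsBlockList isBL

  private
    block-⊆ : ∀ {R Bs Cs B C x} → IsBlockList R Bs → IsBlockList R Cs → B ∈ Bs → C ∈ Cs →
              x ∈ B → x ∈ C → (∀ {y} → y ∈ concat Bs → y ∈ concat Cs) → ∀ {y} → y ∈ B → y ∈ C
    block-⊆ isBs isCs B∈Bs C∈Cs x∈B x∈C Bs⊆Cs y∈B = IsBlockList.closed isCs C∈Cs x∈C
      (Bs⊆Cs (∈-concat⁺′ y∈B B∈Bs)) (IsBlockList.related isBs B∈Bs x∈B y∈B)

    drop-block : ∀ {B C : List (Fin n)} {Bs Cs} → Unique (B ++ concat Bs) →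
                 (∀ {y} → y ∈ C → y ∈ B) → (∀ {y} → y ∈ B ++ concat Bs → y ∈ C ++ concat Cs) →
                 ∀ {y} → y ∈ concat Bs → y ∈ concat Cs
    drop-block {B} {C} B∷Bs! C⊆B B∷Bs⊆C∷Cs y∈Bs with ∈-++⁻ C (B∷Bs⊆C∷Cs (∈-++⁺ʳ B y∈Bs))
    ... | inj₁ y∈C  = ⊥-elim (Unique-++-disjoint B B∷Bs! (C⊆B y∈C) y∈Bs)
    ... | inj₂ y∈Cs = y∈Cs

  blockSizes-↭ : ∀ {R} Bs Cs → IsBlockList R Bs → IsBlockList R Cs →
                 (∀ {x} → x ∈ concat Bs → x ∈ concat Cs) → (∀ {x} → x ∈ concat Cs → x ∈ concat Bs) →
                 map length Bs ↭ map length Cs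
  blockSizes-↭ []       []       _    _    _ _ = Perm.refl
  blockSizes-↭ []       (C ∷ Cs) _    isCs _ Cs⊆[] with IsBlockList.nonEmpty isCs (here refl)
  ... | x , x∈C with Cs⊆[] (∈-++⁺ˡ x∈C)
  ... | ()
  blockSizes-↭ (B ∷ Bs) Cs isBs isCs Bs⊆Cs Cs⊆Bs with IsBlockList.nonEmpty isBs (here refl)
  ... | x , x∈B with ∈-concat⁻′ Cs (Bs⊆Cs (∈-++⁺ˡ x∈B))
  ... | C , x∈C , C∈Cs with ∈-∃++ C∈Cs
  ... | P , Q , refl = begin
    length B ∷ map length Bs         ↭⟨ prep (length B) (blockSizes-↭ Bs (P ++ Q) (IsBlockList-tail isBs)
                                                          (IsBlockList-tail isC∷PQ) Bs⊆PQ PQ⊆Bs) ⟩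
    length B ∷ map length (P ++ Q)   ≡⟨ cong (_∷ map length (P ++ Q)) |B|≡|C| ⟩
    length C ∷ map length (P ++ Q)   ↭⟨ ↭.map⁺ length (↭-sym (↭.shift C P Q)) ⟩
    map length (P ++ C ∷ Q)          ∎
    where
      open Perm.PermutationReasoning
      isC∷PQ = IsBlockList-↭ (↭.shift C P Q) isCs
      toC∷PQ : ∀ {y} → y ∈ concat (P ++ C ∷ Q) → y ∈ concat (C ∷ P ++ Q)
      toC∷PQ = ↭.∈-resp-↭ (concat-↭ (↭.shift C P Q))
      fromC∷PQ : ∀ {y} → y ∈ concat (C ∷ P ++ Q) → y ∈ concat (P ++ C ∷ Q)
      fromC∷PQ = ↭.∈-resp-↭ (concat-↭ (↭-sym (↭.shift C P Q)))
      B⊆C : ∀ {y} → y ∈ B → y ∈ C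
      B⊆C = block-⊆ isBs isC∷PQ (here refl) (here refl) x∈B x∈C (toC∷PQ ∘ Bs⊆Cs)
      C⊆B : ∀ {y} → y ∈ C → y ∈ B
      C⊆B = block-⊆ isC∷PQ isBs (here refl) (here refl) x∈C x∈B (Cs⊆Bs ∘ fromC∷PQ)
      |B|≡|C| : length B ≡ length C
      |B|≡|C| = ↭.↭-length (Unique-same-elements-↭ (Unique-++⁻ˡ B (IsBlockList.unique isBs))
                  (Unique-++⁻ˡ C (IsBlockList.unique isC∷PQ)) B⊆C C⊆B)
      Bs⊆PQ : ∀ {y} → y ∈ concat Bs → y ∈ concat (P ++ Q)
      Bs⊆PQ = drop-block {Bs = Bs} {Cs = P ++ Q} (IsBlockList.unique isBs) C⊆B (toC∷PQ ∘ Bs⊆Cs)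
      PQ⊆Bs : ∀ {y} → y ∈ concat (P ++ Q) → y ∈ concat Bs
      PQ⊆Bs = drop-block {Bs = P ++ Q} {Cs = Bs} (IsBlockList.unique isC∷PQ) B⊆C (Cs⊆Bs ∘ fromC∷PQ)

module _ {n : ℕ} where
  blockOf : BRel n → Fin n → List (Fin n)
  blockOf R i = filterᵇ (R i) (allFin n)

  blockMins : BRel n → List (Fin n)
  blockMins R = filterᵇ (isMinOfBlock R) (allFin n)

  blocks : BRel n → List (List (Fin n))
  blocks R = map (blockOf R) (blockMins R)

  type-blocks : ∀ R → type R ≡ sort (map length (blocks R))
  type-blocks R = cong sort (List.map-∘ (blockMins R))

  kParts-type : ∀ R → kParts (type R) ≡ numBlocks R
  kParts-type R = trans (↭.↭-length (Sort.sort-↭ (map (blockSize R) (blockMins R))))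
                        (List.length-map (blockSize R) (blockMins R))

  blocks-IsBlockList : ∀ {R} → IsPartition R → IsBlockList R (blocks R)
  blocks-IsBlockList {R} isP = record
    { unique   = Unique-concatMap (blockOf R) (Unique.filter⁺ _ (Unique.allFin⁺ n))
                   (λ _ → Unique.filter⁺ _ (Unique.allFin⁺ n)) disjoint
    ; nonEmpty = nonEmpty
    ; related  = related
    ; closed   = closed
    }
    where
      open IsPartition isP
      inBlock : ∀ {m x} → x ∈ blockOf R m → T (R m x)
      inBlock = ∈-filterᵇ-allFin⁻ (R _)
      disjoint : ∀ {m m′} → m ∈ blockMins R → m′ ∈ blockMins R → m ≢ m′ →
                 ∀ {v} → v ∈ blockOf R m → ¬ v ∈ blockOf R m′
      disjoint {m} {m′} m∈ m′∈ m≢m′ v∈ v∈′ = m≢m′ (blockMin-unique R isP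
        (∈-filterᵇ-allFin⁻ (isMinOfBlock R) m∈) (∈-filterᵇ-allFin⁻ (isMinOfBlock R) m′∈)
        (transitive m _ m′ (inBlock v∈) (symmetric m′ _ (inBlock v∈′))))
      nonEmpty : ∀ {B} → B ∈ blocks R → ∃[ x ] x ∈ B
      nonEmpty B∈ with ∈-map⁻ (blockOf R) B∈
      ... | m , _ , refl = m , ∈-filterᵇ-allFin⁺ (R m) (reflexive m)
      related : ∀ {B} → B ∈ blocks R → ∀ {x y} → x ∈ B → y ∈ B → T (R x y)
      related B∈ x∈ y∈ with ∈-map⁻ (blockOf R) B∈
      ... | m , _ , refl = transitive _ m _ (symmetric m _ (inBlock x∈)) (inBlock y∈)
      closed : ∀ {B} → B ∈ blocks R → ∀ {x y} → x ∈ B → y ∈ concat (blocks R) → T (R x y) → y ∈ B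
      closed B∈ x∈ _ rxy with ∈-map⁻ (blockOf R) B∈
      ... | m , _ , refl = ∈-filterᵇ-allFin⁺ (R m) (transitive m _ _ (inBlock x∈) rxy)

  blocks-cover : ∀ {R} → IsPartition R → ∀ i → i ∈ concat (blocks R)
  blocks-cover {R} isP i with blockMin R isP i
  ... | m , rim , isMin = ∈-concat⁺′ (∈-filterᵇ-allFin⁺ (R m) (IsPartition.symmetric isP i m rim))
                                     (∈-map⁺ (blockOf R) (∈-filterᵇ-allFin⁺ (isMinOfBlock R) isMin))

  type-IsBlockList : ∀ {R Bs} → IsPartition R → IsBlockList R Bs → (∀ i → i ∈ concat Bs) →
                     type R ≡ sort (map length Bs)
  type-IsBlockList {R} {Bs} isP isBs Bs-cover = trans (type-blocks R) (sort-↭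
    (blockSizes-↭ (blocks R) Bs (blocks-IsBlockList isP) isBs (λ {x} _ → Bs-cover x) (λ {x} _ → blocks-cover isP x)))

  module _ (ρ : Permutation′ n) where
    IsBlockList-relabel : ∀ {R Bs} → IsBlockList R Bs → IsBlockList (relabel ρ R) (map (map (ρ ⟨$⟩ˡ_)) Bs)
    IsBlockList-relabel {R} {Bs} isBs = record
      { unique   = subst Unique (sym (List.concat-map Bs)) (Unique.map⁺ ρˡ-injective unique)
      ; nonEmpty = nonEmpty′
      ; related  = related′
      ; closed   = closed′
      }
      where
        open IsBlockList isBs
        ρˡ-injective : ∀ {x y} → ρ ⟨$⟩ˡ x ≡ ρ ⟨$⟩ˡ y → x ≡ y
        ρˡ-injective {x} {y} eq = trans (sym (inverseʳ ρ)) (trans (cong (ρ ⟨$⟩ʳ_) eq) (inverseʳ ρ))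
        R-ρˡ : ∀ x y → relabel ρ R (ρ ⟨$⟩ˡ x) (ρ ⟨$⟩ˡ y) ≡ R x y
        R-ρˡ x y = cong₂ R (inverseʳ ρ) (inverseʳ ρ)
        nonEmpty′ : ∀ {B} → B ∈ map (map (ρ ⟨$⟩ˡ_)) Bs → ∃[ x ] x ∈ B
        nonEmpty′ B∈ with ∈-map⁻ (map (ρ ⟨$⟩ˡ_)) B∈
        ... | B , B∈Bs , refl = ρ ⟨$⟩ˡ proj₁ (nonEmpty B∈Bs) , ∈-map⁺ (ρ ⟨$⟩ˡ_) (proj₂ (nonEmpty B∈Bs))
        related′ : ∀ {B} → B ∈ map (map (ρ ⟨$⟩ˡ_)) Bs → ∀ {x y} → x ∈ B → y ∈ B → T (relabel ρ R x y)
        related′ B∈ x∈ y∈ with ∈-map⁻ (map (ρ ⟨$⟩ˡ_)) B∈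
        ... | B , B∈Bs , refl with ∈-map⁻ (ρ ⟨$⟩ˡ_) x∈ | ∈-map⁻ (ρ ⟨$⟩ˡ_) y∈
        ... | x , x∈B , refl | y , y∈B , refl = subst T (sym (R-ρˡ x y)) (related B∈Bs x∈B y∈B)
        closed′ : ∀ {B} → B ∈ map (map (ρ ⟨$⟩ˡ_)) Bs → ∀ {x y} → x ∈ B →
                  y ∈ concat (map (map (ρ ⟨$⟩ˡ_)) Bs) → T (relabel ρ R x y) → y ∈ B
        closed′ B∈ x∈ y∈ rxy with ∈-map⁻ (map (ρ ⟨$⟩ˡ_)) B∈
        ... | B , B∈Bs , refl
          with ∈-map⁻ (ρ ⟨$⟩ˡ_) x∈ | ∈-map⁻ (ρ ⟨$⟩ˡ_) (subst (_ ∈_) (List.concat-map Bs) y∈)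
        ... | x , x∈B , refl | y , y∈Bs , refl =
          ∈-map⁺ (ρ ⟨$⟩ˡ_) (closed B∈Bs x∈B y∈Bs (subst T (R-ρˡ x y) rxy))

    cover-relabel : ∀ {Bs} → (∀ i → i ∈ concat Bs) → ∀ i → i ∈ concat (map (map (ρ ⟨$⟩ˡ_)) Bs)
    cover-relabel {Bs} cover i = subst (_∈ concat (map (map (ρ ⟨$⟩ˡ_)) Bs)) (inverseˡ ρ)
      (subst (_ ∈_) (sym (List.concat-map Bs)) (∈-map⁺ (ρ ⟨$⟩ˡ_) (cover (ρ ⟨$⟩ʳ i))))

    type-relabel : ∀ {R} → IsPartition R → type (relabel ρ R) ≡ type R
    type-relabel {R} isP = begin
      type (relabel ρ R)
        ≡⟨ type-IsBlockList (IsPartition-relabel ρ isP) (IsBlockList-relabel {R} {blocks R} (blocks-IsBlockList isP))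
                            (cover-relabel {blocks R} (blocks-cover isP)) ⟩
      sort (map length (map (map (ρ ⟨$⟩ˡ_)) (blocks R)))
        ≡⟨ cong sort (trans (sym (List.map-∘ (blocks R))) (List.map-cong (List.length-map _) (blocks R))) ⟩
      sort (map length (blocks R))
        ≡⟨ type-blocks R ⟨
      type R ∎
      where open ≡-Reasoning

-- The numbers a_{τ,τ′} count coarsenings

module _ {X : Set} where
  insertBySize : List X → List (List X) → List (List X)
  insertBySize B []       = B ∷ []
  insertBySize B (C ∷ Cs) = if does (length B ℕ.≤? length C) then B ∷ C ∷ Cs else C ∷ insertBySize B Cs

  sortBySize : List (List X) → List (List X)
  sortBySize []       = []
  sortBySize (B ∷ Bs) = insertBySize B (sortBySize Bs)

  length-insertBySize : ∀ B Cs → map length (insertBySize B Cs) ≡ insert (length B) (map length Cs)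
  length-insertBySize B []       = refl
  length-insertBySize B (C ∷ Cs) with does (length B ℕ.≤? length C)
  ... | true  = refl
  ... | false = cong (length C ∷_) (length-insertBySize B Cs)

  length-sortBySize : ∀ Bs → map length (sortBySize Bs) ≡ sort (map length Bs)
  length-sortBySize []       = refl
  length-sortBySize (B ∷ Bs) = trans (length-insertBySize B (sortBySize Bs)) (cong (insert (length B)) (length-sortBySize Bs))

  insertBySize-↭ : ∀ B Cs → insertBySize B Cs ↭ B ∷ Cs
  insertBySize-↭ B []       = Perm.refl
  insertBySize-↭ B (C ∷ Cs) with does (length B ℕ.≤? length C)
  ... | true  = Perm.refl
  ... | false = ↭-trans (prep C (insertBySize-↭ B Cs)) (swap C B Perm.refl)

  sortBySize-↭ : ∀ Bs → sortBySize Bs ↭ Bs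
  sortBySize-↭ []       = Perm.refl
  sortBySize-↭ (B ∷ Bs) = ↭-trans (insertBySize-↭ B (sortBySize Bs)) (prep B (sortBySize-↭ Bs))

data _[_]=_ {A : Set} : List A → ℕ → A → Set where
  at-head : ∀ {x xs} → (x ∷ xs) [ 0 ]= x
  at-tail : ∀ {k x y xs} → xs [ k ]= x → (y ∷ xs) [ suc k ]= x

module _ {A : Set} where
  []=⇒∈ : ∀ {xs k} {x : A} → xs [ k ]= x → x ∈ xs
  []=⇒∈ at-head     = here refl
  []=⇒∈ (at-tail p) = there ([]=⇒∈ p)

  lookup-[]= : ∀ (xs : List A) i → xs [ toℕ i ]= lookup xs i
  lookup-[]= (x ∷ xs) Fin.zero    = at-head
  lookup-[]= (x ∷ xs) (Fin.suc i) = at-tail (lookup-[]= xs i)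

  []=-functional : ∀ {xs k} {x y : A} → xs [ k ]= x → xs [ k ]= y → x ≡ y
  []=-functional at-head     at-head     = refl
  []=-functional (at-tail p) (at-tail q) = []=-functional p q

  []=-injective : ∀ {xs k l} {x : A} → Unique xs → xs [ k ]= x → xs [ l ]= x → k ≡ l
  []=-injective _         at-head     at-head     = refl
  []=-injective (x∉ ∷ _)  at-head     (at-tail q) = ⊥-elim (All.lookup x∉ ([]=⇒∈ q) refl)
  []=-injective (x∉ ∷ _)  (at-tail p) at-head     = ⊥-elim (All.lookup x∉ ([]=⇒∈ p) refl)
  []=-injective (_ ∷ xs!) (at-tail p) (at-tail q) = cong suc ([]=-injective xs! p q)

  []=-++ : ∀ xs {ys k} {x : A} → (xs ++ ys) [ k ]= x →
           (k < length xs × xs [ k ]= x) ⊎ (length xs ≤ k × ys [ k ∸ length xs ]= x)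
  []=-++ []       p           = inj₂ (z≤n , p)
  []=-++ (x ∷ xs) at-head     = inj₁ (s≤s z≤n , at-head)
  []=-++ (x ∷ xs) (at-tail p) with []=-++ xs p
  ... | inj₁ (k<|xs| , q) = inj₁ (s≤s k<|xs| , at-tail q)
  ... | inj₂ (|xs|≤k , q) = inj₂ (s≤s |xs|≤k , q)

blockIndex-< : ∀ {m k} τ → k < m → blockIndex (m ∷ τ) k ≡ 0
blockIndex-< {m} {k} τ k<m with k <ᵇ m | ℕ.<⇒<ᵇ k<m
... | true | _ = refl

blockIndex-≥ : ∀ {m k} τ → m ≤ k → blockIndex (m ∷ τ) k ≡ suc (blockIndex τ (k ∸ m))
blockIndex-≥ {m} {k} τ m≤k with k <ᵇ m | ℕ.<ᵇ⇒< k m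
... | true  | k<m = ⊥-elim (ℕ.≤⇒≯ m≤k (k<m _))
... | false | _   = refl

module _ {A : Set} where
  []=-concat : ∀ (Bs : List (List A)) {k x} → concat Bs [ k ]= x →
               ∃[ B ] Bs [ blockIndex (map length Bs) k ]= B × x ∈ B
  []=-concat (B ∷ Bs) {k} p with []=-++ B p
  ... | inj₁ (k<|B| , q) rewrite blockIndex-< (map length Bs) k<|B| = B , at-head , []=⇒∈ q
  ... | inj₂ (|B|≤k , q) rewrite blockIndex-≥ (map length Bs) |B|≤k with []=-concat Bs q
  ...   | C , Bs[j]=C , x∈C = C , at-tail Bs[j]=C , x∈C

  []=-concat-injective : ∀ (Bs : List (List A)) {k l B C y} → Unique (concat Bs) →
                         Bs [ k ]= B → Bs [ l ]= C → y ∈ B → y ∈ C → k ≡ l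
  []=-concat-injective (B ∷ Bs) _ at-head     at-head     _   _   = refl
  []=-concat-injective (B ∷ Bs) u at-head     (at-tail q) y∈B y∈C =
    ⊥-elim (Unique-++-disjoint B u y∈B (∈-concat⁺′ y∈C ([]=⇒∈ q)))
  []=-concat-injective (B ∷ Bs) u (at-tail p) at-head     y∈B y∈C =
    ⊥-elim (Unique-++-disjoint B u y∈C (∈-concat⁺′ y∈B ([]=⇒∈ p)))
  []=-concat-injective (B ∷ Bs) u (at-tail p) (at-tail q) y∈B y∈C =
    cong suc ([]=-concat-injective Bs (Unique-++⁻ʳ B u) p q y∈B y∈C)

module Enumeration {n : ℕ} {R : BRel n} (Bs : List (List (Fin n))) (isBs : IsBlockList R Bs)
                   (cover : ∀ i → i ∈ concat Bs) where
  open IsBlockList isBs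

  length-concat : length (concat Bs) ≡ n
  length-concat = trans
    (↭.↭-length (Unique-same-elements-↭ unique (Unique.allFin⁺ n) (λ {x} _ → ∈-allFin x) (λ {x} _ → cover x)))
    (List.length-tabulate id)

  position : Fin n → Fin n
  position x = Fin.cast length-concat (Any.index (cover x))

  element : Fin n → Fin n
  element p = lookup (concat Bs) (Fin.cast (sym length-concat) p)

  element-[]= : ∀ p → concat Bs [ toℕ p ]= element p
  element-[]= p = subst (concat Bs [_]= element p) (Fin.toℕ-cast (sym length-concat) p)
                        (lookup-[]= (concat Bs) (Fin.cast (sym length-concat) p))

  element-position : ∀ x → element (position x) ≡ x
  element-position x = trans (cong (lookup (concat Bs)) (Fin.cast-involutive (sym length-concat) length-concat _))
                             (sym (Any.lookup-index (cover x)))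

  position-element : ∀ p → position (element p) ≡ p
  position-element p = Fin.toℕ-injective ([]=-injective unique
    (subst (concat Bs [ toℕ (position (element p)) ]=_) (element-position (element p)) (element-[]= (position (element p))))
    (element-[]= p))

  enumeration : Permutation′ n
  enumeration = permutation element position element-position position-element

  canonPartition-relabel : canonPartition n (map length Bs) ≐ relabel enumeration R
  canonPartition-relabel p q with []=-concat Bs (element-[]= p) | []=-concat Bs (element-[]= q)
  ... | B , Bs[k]=B , x∈B | C , Bs[l]=C , y∈C = T-ext same-block⇒related related⇒same-block
    where
      k = blockIndex (map length Bs) (toℕ p)
      l = blockIndex (map length Bs) (toℕ q)
      same-block⇒related : T (k ≡ᵇ l) → T (R (element p) (element q))
      same-block⇒related k≡ᵇl = related ([]=⇒∈ Bs[k]=B) x∈B (subst (element q ∈_) C≡B y∈C)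
        where
          C≡B : C ≡ B
          C≡B = []=-functional (subst (Bs [_]= C) (sym (ℕ.≡ᵇ⇒≡ k l k≡ᵇl)) Bs[l]=C) Bs[k]=B
      related⇒same-block : T (R (element p) (element q)) → T (k ≡ᵇ l)
      related⇒same-block r = ℕ.≡⇒≡ᵇ k l ([]=-concat-injective Bs unique Bs[k]=B Bs[l]=C
        (closed ([]=⇒∈ Bs[k]=B) x∈B ([]=⇒∈ (element-[]= q)) r) y∈C)

module _ {n : ℕ} where
  type-resp-≐ : ∀ {R S : BRel n} → R ≐ S → type R ≡ type S
  type-resp-≐ {R} {S} R≐S = cong sort (trans
    (cong (map (blockSize R)) (filterᵇ-cong isMin-≡ (allFin n)))
    (List.map-cong (λ i → cong length (filterᵇ-cong (R≐S i) (allFin n))) _))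
    where
      isMin-≡ : ∀ i → isMinOfBlock R i ≡ isMinOfBlock S i
      isMin-≡ i = cong (not ∘ or) (List.map-cong (λ j → cong ((toℕ j <ᵇ toℕ i) ∧_) (R≐S i j)) (allFin n))

  coarseningOfTypeᵇ : BRel n → IntPartition → BRel n → Bool
  coarseningOfTypeᵇ R τ′ π = isEquivᵇ π ∧ (isCoarseningᵇ R π ∧ (type π ==ₚ τ′))

  coarseningCount : BRel n → IntPartition → ℕ
  coarseningCount R τ′ = count (λ π → isCoarseningᵇ R π ∧ (type π ==ₚ τ′)) (setPartitions n)

  coarseningCount-allBRels : ∀ R τ′ → coarseningCount R τ′ ≡ count (coarseningOfTypeᵇ R τ′) (allBRels n)
  coarseningCount-allBRels R τ′ = count-filterᵇ isEquivᵇ _ (allBRels n)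

  coarseningOfTypeᵇ-extensional : ∀ R τ′ → Extensional (coarseningOfTypeᵇ R τ′)
  coarseningOfTypeᵇ-extensional R τ′ π≐π′ = cong₂ _∧_ (isEquivᵇ-resp-≐ π≐π′)
    (cong₂ _∧_ (isCoarseningᵇ-resp-≐ (λ _ _ → refl) π≐π′) (cong (_==ₚ τ′) (type-resp-≐ π≐π′)))

  coarseningOfTypeᵇ-relabel : ∀ ρ R τ′ π →
                              coarseningOfTypeᵇ (relabel ρ R) τ′ (relabel ρ π) ≡ coarseningOfTypeᵇ R τ′ π
  coarseningOfTypeᵇ-relabel ρ R τ′ π = ∧-cong-T (isEquivᵇ-relabel ρ π) λ π-isEquiv →
    cong₂ _∧_ (isCoarseningᵇ-relabel ρ R π) (cong (_==ₚ τ′) (type-relabel ρ (isEquivᵇ-sound π π-isEquiv)))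

  a-coarseningCount : ∀ {R} → IsPartition R → ∀ τ′ → a n (type R) τ′ ≡ coarseningCount R τ′
  a-coarseningCount {R} isP τ′ = begin
    a n (type R) τ′
      ≡⟨ cong (λ τ → coarseningCount (canonPartition n τ) τ′) sizes≡type ⟨
    coarseningCount (canonPartition n (map length Bs)) τ′
      ≡⟨ coarseningCount-allBRels _ τ′ ⟩
    count (coarseningOfTypeᵇ (canonPartition n (map length Bs)) τ′) (allBRels n)
      ≡⟨ count-cong (λ π → cong (isEquivᵇ π ∧_) (cong (_∧ (type π ==ₚ τ′))
           (isCoarseningᵇ-resp-≐ canonPartition-relabel (λ _ _ → refl)))) (allBRels n) ⟩
    count (coarseningOfTypeᵇ (relabel enumeration R) τ′) (allBRels n)
      ≡⟨ count-allBRels-relabel enumeration _ (coarseningOfTypeᵇ-extensional _ τ′) ⟨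
    count (coarseningOfTypeᵇ (relabel enumeration R) τ′ ∘ relabel enumeration) (allBRels n)
      ≡⟨ count-cong (coarseningOfTypeᵇ-relabel enumeration R τ′) (allBRels n) ⟩
    count (coarseningOfTypeᵇ R τ′) (allBRels n)
      ≡⟨ coarseningCount-allBRels R τ′ ⟨
    coarseningCount R τ′ ∎
    where
      open ≡-Reasoning
      -- canonPartition n τ lays out its blocks in the order of τ, hence the sorting.
      Bs = sortBySize (blocks R)
      blocks↭Bs : blocks R ↭ Bs
      blocks↭Bs = ↭-sym (sortBySize-↭ (blocks R))
      sizes≡type : map length Bs ≡ type R
      sizes≡type = trans (length-sortBySize (blocks R)) (sym (type-blocks R))
      open Enumeration Bs (IsBlockList-↭ blocks↭Bs (blocks-IsBlockList isP))
                       (λ i → ↭.∈-resp-↭ (concat-↭ blocks↭Bs) (blocks-cover isP i))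

-- Connectivity of spanning subgraphs

module _ {n : ℕ} where
  Edges : Set
  Edges = List (Fin n × Fin n)

  Adjacent : Edges → Fin n → Fin n → Set
  Adjacent A u v = (u , v) ∈ A ⊎ (v , u) ∈ A

  data Path (A : Edges) (i : Fin n) : Fin n → Set where
    []  : Path A i i
    _▷_ : ∀ {j k} → Path A i j → Adjacent A j k → Path A i k

  infixl 5 _▷_ _++ₚ_

  _++ₚ_ : ∀ {A i j k} → Path A i j → Path A j k → Path A i k
  p ++ₚ []      = p
  p ++ₚ (q ▷ e) = (p ++ₚ q) ▷ e

  reverseₚ : ∀ {A i j} → Path A i j → Path A j i
  reverseₚ []                = []
  reverseₚ (p ▷ inj₁ uv∈A) = ([] ▷ inj₂ uv∈A) ++ₚ reverseₚ p
  reverseₚ (p ▷ inj₂ vu∈A) = ([] ▷ inj₁ vu∈A) ++ₚ reverseₚ p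

  vertices : ∀ {A i j} → Path A i j → List (Fin n)
  vertices {i = i} []        = i ∷ []
  vertices {j = k} (p ▷ _) = k ∷ vertices p

  private
    truncate : ∀ {A i j k} (p : Path A i j) → Unique (vertices p) → k ∈ vertices p →
               ∃[ q ] Unique (vertices {A} {i} {k} q)
    truncate []      p! (here refl)  = [] , p!
    truncate (p ▷ e) p! (here refl)  = p ▷ e , p!
    truncate (p ▷ e) (_ ∷ p!) (there k∈) = truncate p p! k∈

  simplify : ∀ {A i j} → Path A i j → ∃[ q ] Unique (vertices {A} {i} {j} q)
  simplify []      = [] , All.[] ∷ []
  simplify {j = k} (p ▷ e) with simplify p
  ... | q , q! with k ∈? vertices q
    where open DecMembership Fin._≟_
  ...   | yes k∈q = truncate q q! k∈q
  ...   | no  k∉q = q ▷ e , All.tabulate (λ k′∈q k≡k′ → k∉q (subst (_∈ vertices q) (sym k≡k′) k′∈q))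
                          ∷ q!

  Unique-length≤ : ∀ {vs : List (Fin n)} → Unique vs → length vs ≤ n
  Unique-length≤ {vs} vs! = begin
    length vs                          ≡⟨ ↭.↭-length (Unique-same-elements-↭ vs! (Unique.filter⁺ (_∈? vs) (Unique.allFin⁺ n))
                                            (λ {x} x∈ → ∈-filter⁺ (_∈? vs) (∈-allFin x) x∈)
                                            (proj₂ ∘ ∈-filter⁻ (_∈? vs) {xs = allFin n})) ⟩
    length (filter (_∈? vs) (allFin n)) ≤⟨ List.length-filter (_∈? vs) (allFin n) ⟩
    length (allFin n)                  ≡⟨ List.length-tabulate id ⟩
    n                                  ∎
    where
      open ℕ.≤-Reasoning
      open DecMembership Fin._≟_

  closure : Edges → ℕ → BRel n
  closure A k = iterate k (closeStep A) diagonal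

  diagonal-reflexive : ∀ i → T (diagonal {n} i i)
  diagonal-reflexive i with i Fin.≟ i
  ... | yes _   = _
  ... | no  i≢i = i≢i refl

  diagonal⇒≡ : ∀ {i j} → T (diagonal {n} i j) → i ≡ j
  diagonal⇒≡ {i} {j} h with i Fin.≟ j
  ... | yes i≡j = i≡j

  closure-reflexive : ∀ A k i → T (closure A k i i)
  closure-reflexive A zero    i = diagonal-reflexive i
  closure-reflexive A (suc k) i = ∨-introˡ (closure-reflexive A k i)

  closure-sound : ∀ A k {i j} → T (closure A k i j) → Path A i j
  closure-sound A zero {i} {j} h with diagonal⇒≡ {i} {j} h
  ... | refl = []
  closure-sound A (suc k) {i} {j} h with ∨-elim {closure A k i j} h
  ... | inj₁ rij = closure-sound A k rij
  ... | inj₂ via-edge with any-∈⁻ _ A via-edge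
  ...   | (u , v) , uv∈A , through with ∨-elim {closure A k i u ∧ closure A k v j} through
  ...     | inj₁ r = (closure-sound A k (∧-elimˡ r) ▷ inj₁ uv∈A)
                       ++ₚ closure-sound A k (∧-elimʳ {closure A k i u} r)
  ...     | inj₂ r = (closure-sound A k (∧-elimˡ r) ▷ inj₂ uv∈A)
                       ++ₚ closure-sound A k (∧-elimʳ {closure A k i v} r)

  closure-complete : ∀ {A i j} (p : Path A i j) k → length (vertices p) ≤ suc k → T (closure A k i j)
  closure-complete {A} {i} []                    k       _           = closure-reflexive A k i
  closure-complete ([] ▷ _)                      zero    (s≤s ())
  closure-complete ((_ ▷ _) ▷ _)                 zero    (s≤s ())
  closure-complete {A} {i} {j} (_▷_ {w} p e) (suc k) (s≤s |p|≤k) =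
    ∨-introʳ {closure A k i j} (via e)
    where
      i~w = closure-complete p k |p|≤k
      j~j = closure-reflexive A k j
      via : Adjacent A w j → T (any _ A)
      via (inj₁ wj∈A) = any-∈⁺ _ wj∈A (∨-introˡ (∧-intro i~w j~j))
      via (inj₂ jw∈A) = any-∈⁺ _ jw∈A (∨-introʳ {closure A k i j ∧ closure A k w j} (∧-intro i~w j~j))

  connected-sound : ∀ {A i j} → T (connected A i j) → Path A i j
  connected-sound {A} = closure-sound A n

  connected-complete : ∀ {A i j} → Path A i j → T (connected A i j)
  connected-complete p with simplify p
  ... | q , q! = closure-complete q n (ℕ.m≤n⇒m≤1+n (Unique-length≤ q!))

  connected-IsPartition : ∀ A → IsPartition (connected A)
  connected-IsPartition A = record
    { reflexive  = λ i → connected-complete {A} []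
    ; symmetric  = λ i j → connected-complete ∘ reverseₚ ∘ connected-sound {A}
    ; transitive = λ i j k rij rjk → connected-complete (connected-sound {A} rij ++ₚ connected-sound rjk)
    }

  connected-⊑ : ∀ {π} → IsPartition π → ∀ A → isCoarseningᵇ (connected A) π ≡ all (λ { (u , v) → π u v }) A
  connected-⊑ {π} isP A = T-ext ⊑⇒edges-inside edges-inside⇒⊑
    where
      open IsPartition isP
      ⊑⇒edges-inside : T (isCoarseningᵇ (connected A) π) → T (all (λ { (u , v) → π u v }) A)
      ⊑⇒edges-inside h = all⁻ _ {A} (All.tabulate λ { {u , v} uv∈A →
        isCoarseningᵇ-sound (connected A) π h u v (connected-complete ([] ▷ inj₁ uv∈A)) })
      edges-inside⇒⊑ : T (all (λ { (u , v) → π u v }) A) → T (isCoarseningᵇ (connected A) π)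
      edges-inside⇒⊑ h = isCoarseningᵇ-complete (connected A) π (λ i j → inside ∘ connected-sound {A})
        where
          edge : ∀ {u v} → (u , v) ∈ A → T (π u v)
          edge = All.lookup (all⁺ _ A h)
          inside : ∀ {i j} → Path A i j → T (π i j)
          inside {i} []              = reflexive i
          inside (p ▷ inj₁ uv∈A) = transitive _ _ _ (inside p) (edge uv∈A)
          inside (p ▷ inj₂ vu∈A) = transitive _ _ _ (inside p) (symmetric _ _ (edge vu∈A))

  Path-[]⇒≡ : ∀ {i j} → Path [] i j → i ≡ j
  Path-[]⇒≡ []             = refl
  Path-[]⇒≡ (_ ▷ inj₁ ())
  Path-[]⇒≡ (_ ▷ inj₂ ())

  Path-∷⁻ : ∀ {u v A i j} → Path ((u , v) ∷ A) i j →
            Path A i j ⊎ (Path A i u × Path A v j) ⊎ (Path A i v × Path A u j)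
  Path-∷⁻ []                   = inj₁ []
  Path-∷⁻ {u} {v} {A} {i} (_▷_ {w} {j} p e) = extend (Path-∷⁻ p) (classify e)
    where
      classify : Adjacent ((u , v) ∷ A) w j → Adjacent A w j ⊎ (w ≡ u × j ≡ v) ⊎ (w ≡ v × j ≡ u)
      classify (inj₁ (here refl))  = inj₂ (inj₁ (refl , refl))
      classify (inj₁ (there wj∈A)) = inj₁ (inj₁ wj∈A)
      classify (inj₂ (here refl))  = inj₂ (inj₂ (refl , refl))
      classify (inj₂ (there jw∈A)) = inj₁ (inj₂ jw∈A)
      extend : Path A i w ⊎ (Path A i u × Path A v w) ⊎ (Path A i v × Path A u w) →
               Adjacent A w j ⊎ (w ≡ u × j ≡ v) ⊎ (w ≡ v × j ≡ u) →
               Path A i j ⊎ (Path A i u × Path A v j) ⊎ (Path A i v × Path A u j)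
      extend (inj₁ p)              (inj₁ e)                  = inj₁ (p ▷ e)
      extend (inj₁ p)              (inj₂ (inj₁ (refl , refl))) = inj₂ (inj₁ (p , []))
      extend (inj₁ p)              (inj₂ (inj₂ (refl , refl))) = inj₂ (inj₂ (p , []))
      extend (inj₂ (inj₁ (p , q))) (inj₁ e)                  = inj₂ (inj₁ (p , q ▷ e))
      extend (inj₂ (inj₁ (p , q))) (inj₂ (inj₁ (refl , refl))) = inj₁ (p ++ₚ reverseₚ q)
      extend (inj₂ (inj₁ (p , q))) (inj₂ (inj₂ (refl , refl))) = inj₁ p
      extend (inj₂ (inj₂ (p , q))) (inj₁ e)                  = inj₂ (inj₂ (p , q ▷ e))
      extend (inj₂ (inj₂ (p , q))) (inj₂ (inj₁ (refl , refl))) = inj₁ p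
      extend (inj₂ (inj₂ (p , q))) (inj₂ (inj₂ (refl , refl))) = inj₁ (p ++ₚ reverseₚ q)

module _ {n : ℕ} where
  numBlocks-connected-[] : numBlocks (connected {n} []) ≡ n
  numBlocks-connected-[] = trans (cong length (List.filter-all (T? ∘ isMinOfBlock (connected []))
                                                (All.tabulate {xs = allFin n} λ {i} _ → isMin i)))
                                 (List.length-tabulate id)
    where
      isMin : ∀ i → T (isMinOfBlock (connected {n} []) i)
      isMin i = not-intro λ h → let j , _ , t = any-∈⁻ _ (allFin n) h in
        ℕ.<-irrefl (cong toℕ (sym (Path-[]⇒≡ (connected-sound (∧-elimʳ {toℕ j <ᵇ toℕ i} t)))))
                   (ℕ.<ᵇ⇒< (toℕ j) (toℕ i) (∧-elimˡ t))

  -- A block minimum of G|A lost by adding uv reaches an endpoint in G|A and, across the edge, a smaller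
  -- vertex. Two lost minima escaping through the same endpoint share a block; through different
  -- endpoints, each would lie below the other.
  numBlocks-connected-∷ : ∀ u v A → numBlocks (connected A) ≤ suc (numBlocks (connected {n} ((u , v) ∷ A)))
  numBlocks-connected-∷ u v A =
    count≤suc-count (isMinOfBlock R) (isMinOfBlock R′) (allFin n) (Unique.allFin⁺ n) (λ _ _ → lost-unique)
    where
      R  = connected A
      R′ = connected ((u , v) ∷ A)
      Escape : Fin n → Set
      Escape x = ∃[ j ] toℕ j < toℕ x × ((Path A x u × Path A v j) ⊎ (Path A x v × Path A u j))
      escape : ∀ {x} → T (isMinOfBlock R x) → ¬ T (isMinOfBlock R′ x) → Escape x
      escape {x} isMin ¬isMin′ with ¬isMinOfBlock⇒related R′ ¬isMin′
      ... | j , j<x , x~′j with Path-∷⁻ (connected-sound x~′j)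
      ...   | inj₁ x~j       = ⊥-elim (isMinOfBlock⇒¬related R isMin j<x (connected-complete x~j))
      ...   | inj₂ via-edge = j , j<x , via-edge
      min≤ : ∀ {x j} → T (isMinOfBlock R x) → Path A x j → toℕ x ≤ toℕ j
      min≤ isMin x~j = ℕ.≮⇒≥ λ j<x → isMinOfBlock⇒¬related R isMin j<x (connected-complete x~j)
      crossed : ∀ {x y j k} → T (isMinOfBlock R x) → T (isMinOfBlock R y) →
                toℕ j < toℕ x → toℕ k < toℕ y → Path A y j → Path A x k → ⊥
      crossed isMinx isMiny j<x k<y y~j x~k = ℕ.<-irrefl refl
        (ℕ.≤-<-trans (min≤ isMiny y~j) (ℕ.<-≤-trans j<x (ℕ.<⇒≤ (ℕ.≤-<-trans (min≤ isMinx x~k) k<y))))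
      lost-unique : ∀ {x y} → T (isMinOfBlock R x) → ¬ T (isMinOfBlock R′ x) →
                    T (isMinOfBlock R y) → ¬ T (isMinOfBlock R′ y) → x ≡ y
      lost-unique isMinx ¬isMin′x isMiny ¬isMin′y with escape isMinx ¬isMin′x | escape isMiny ¬isMin′y
      ... | _ , _ , inj₁ (x~u , _) | _ , _ , inj₁ (y~u , _) =
        blockMin-unique R (connected-IsPartition A) isMinx isMiny (connected-complete (x~u ++ₚ reverseₚ y~u))
      ... | _ , _ , inj₂ (x~v , _) | _ , _ , inj₂ (y~v , _) =
        blockMin-unique R (connected-IsPartition A) isMinx isMiny (connected-complete (x~v ++ₚ reverseₚ y~v))
      ... | _ , j<x , inj₁ (x~u , v~j) | _ , k<y , inj₂ (y~v , u~k) =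
        ⊥-elim (crossed isMinx isMiny j<x k<y (y~v ++ₚ v~j) (x~u ++ₚ u~k))
      ... | _ , j<x , inj₂ (x~v , u~j) | _ , k<y , inj₁ (y~u , v~k) =
        ⊥-elim (crossed isMinx isMiny j<x k<y (y~u ++ₚ u~j) (x~v ++ₚ v~k))

  n≤numBlocks+length : ∀ (A : Edges) → n ≤ numBlocks (connected A) ℕ.+ length A
  n≤numBlocks+length []            = ℕ.≤-reflexive (trans (sym numBlocks-connected-[]) (sym (ℕ.+-identityʳ _)))
  n≤numBlocks+length ((u , v) ∷ A) = ℕ.≤-trans (n≤numBlocks+length A) (begin
    numBlocks (connected A) ℕ.+ length A             ≤⟨ ℕ.+-monoˡ-≤ (length A) (numBlocks-connected-∷ u v A) ⟩
    suc (numBlocks (connected ((u , v) ∷ A))) ℕ.+ length A ≡⟨ ℕ.+-suc _ (length A) ⟨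
    numBlocks (connected ((u , v) ∷ A)) ℕ.+ suc (length A) ∎)
    where open ℕ.≤-Reasoning

∑ : ∀ {X : Set} → (X → ℤ) → List X → ℤ
∑ f []       = 0ℤ
∑ f (x ∷ xs) = f x + ∑ f xs

module _ {X : Set} where
  ∑-++ : ∀ (f : X → ℤ) xs ys → ∑ f (xs ++ ys) ≡ ∑ f xs + ∑ f ys
  ∑-++ f []       ys = sym (ℤ.+-identityˡ _)
  ∑-++ f (x ∷ xs) ys = trans (cong (λ s → f x + s) (∑-++ f xs ys)) (sym (ℤ.+-assoc (f x) _ _))

  ∑-cong : ∀ {f g : X → ℤ} → (∀ x → f x ≡ g x) → ∀ xs → ∑ f xs ≡ ∑ g xs
  ∑-cong f≗g []       = refl
  ∑-cong f≗g (x ∷ xs) = cong₂ _+_ (f≗g x) (∑-cong f≗g xs)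

  ∑-zero : ∀ xs → ∑ (λ (_ : X) → 0ℤ) xs ≡ 0ℤ
  ∑-zero []       = refl
  ∑-zero (x ∷ xs) = trans (ℤ.+-identityˡ _) (∑-zero xs)

  ∑-*ˡ : ∀ c (f : X → ℤ) xs → ∑ (λ x → c * f x) xs ≡ c * ∑ f xs
  ∑-*ˡ c f []       = sym (ℤ.*-zeroʳ c)
  ∑-*ˡ c f (x ∷ xs) = trans (cong (λ s → c * f x + s) (∑-*ˡ c f xs)) (sym (ℤ.*-distribˡ-+ c (f x) _))

  ∑-+ : ∀ (f g : X → ℤ) xs → ∑ (λ x → f x + g x) xs ≡ ∑ f xs + ∑ g xs
  ∑-+ f g []       = refl
  ∑-+ f g (x ∷ xs) = trans (cong (λ s → f x + g x + s) (∑-+ f g xs)) (interchange (f x) (g x) (∑ f xs) (∑ g xs))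
    where
      interchange : ∀ a b c d → (a + b) + (c + d) ≡ (a + c) + (b + d)
      interchange = solve-∀

  ∑-if : ∀ (p : X → Bool) w xs → + count p xs * w ≡ ∑ (λ x → if p x then w else 0ℤ) xs
  ∑-if p w []       = ℤ.*-zeroˡ w
  ∑-if p w (x ∷ xs) with p x
  ... | true  = trans (ℤ.*-distribʳ-+ w 1ℤ (+ count p xs)) (cong₂ _+_ (ℤ.*-identityˡ w) (∑-if p w xs))
  ... | false = trans (∑-if p w xs) (sym (ℤ.+-identityˡ _))

  ∑-filterᵇ-cong : ∀ (p : X → Bool) {f g : X → ℤ} → (∀ x → T (p x) → f x ≡ g x) →
                   ∀ xs → ∑ f (filterᵇ p xs) ≡ ∑ g (filterᵇ p xs)
  ∑-filterᵇ-cong p f≗g []       = refl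
  ∑-filterᵇ-cong p f≗g (x ∷ xs) with p x in px
  ... | true  = cong₂ _+_ (f≗g x (subst T (sym px) _)) (∑-filterᵇ-cong p f≗g xs)
  ... | false = ∑-filterᵇ-cong p f≗g xs

module _ {X Y : Set} where
  ∑-map : ∀ (f : Y → ℤ) (g : X → Y) xs → ∑ f (map g xs) ≡ ∑ (f ∘ g) xs
  ∑-map f g []       = refl
  ∑-map f g (x ∷ xs) = cong (λ s → f (g x) + s) (∑-map f g xs)

  ∑-comm : ∀ (f : X → Y → ℤ) xs ys → ∑ (λ x → ∑ (f x) ys) xs ≡ ∑ (λ y → ∑ (λ x → f x y) xs) ys
  ∑-comm f []       ys = sym (∑-zero ys)
  ∑-comm f (x ∷ xs) ys = trans (cong (λ s → ∑ (f x) ys + s) (∑-comm f xs ys))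
                               (sym (∑-+ (f x) (λ y → ∑ (λ x → f x y) xs) ys))

module _ {X : Set} (y : ℤ) (inside : X → Bool) where
  ∑-subsets : ∀ E → ∑ (λ A → if all inside A then (y - 1ℤ) ^ length A else 0ℤ) (subsets E)
                    ≡ y ^ length (filterᵇ inside E)
  ∑-subsets []      = refl
  ∑-subsets (x ∷ E) = begin
    ∑ f (subsets E ++ map (x ∷_) (subsets E)) ≡⟨ ∑-++ f (subsets E) _ ⟩
    S + ∑ f (map (x ∷_) (subsets E))         ≡⟨ cong (λ t → S + t) (∑-map f (x ∷_) (subsets E)) ⟩
    S + ∑ (f ∘ (x ∷_)) (subsets E)           ≡⟨ by-cases (inside x) refl ⟩
    y ^ length (filterᵇ inside (x ∷ E))      ∎
    where
      open ≡-Reasoning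
      z = y - 1ℤ
      f = λ A → if all inside A then z ^ length A else 0ℤ
      S = ∑ f (subsets E)
      k = length (filterᵇ inside E)
      by-cases : ∀ b → inside x ≡ b →
                 S + ∑ (λ A → if b ∧ all inside A then z ^ suc (length A) else 0ℤ) (subsets E)
                   ≡ y ^ length (filterᵇ inside (x ∷ E))
      by-cases true  x-inside rewrite x-inside = begin
        S + ∑ (λ A → if all inside A then z ^ suc (length A) else 0ℤ) (subsets E)
          ≡⟨ cong (λ t → S + t) (∑-cong (λ A → pull-z (all inside A) {length A}) (subsets E)) ⟩
        S + ∑ (λ A → z * f A) (subsets E) ≡⟨ cong (λ t → S + t) (∑-*ˡ z f (subsets E)) ⟩
        S + z * S                         ≡⟨ cong (λ t → t + z * t) (∑-subsets E) ⟩
        y ^ k + z * y ^ k                 ≡⟨ ring (y ^ k) y ⟩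
        y * y ^ k                         ∎
        where
          pull-z : ∀ b {m} → (if b then z ^ suc m else 0ℤ) ≡ z * (if b then z ^ m else 0ℤ)
          pull-z true  = refl
          pull-z false = sym (ℤ.*-zeroʳ z)
          ring : ∀ s y → s + (y - 1ℤ) * s ≡ y * s
          ring = solve-∀
      by-cases false x-outside rewrite x-outside =
        trans (cong (λ t → S + t) (∑-zero (subsets E))) (trans (ℤ.+-identityʳ S) (∑-subsets E))

-- The coefficients of χ_G and of the substituted U_G

module _ {X : Set} (g : X → IntPartition × (ℤ → ℤ)) (τ : IntPartition) (y : ℤ) where
  Φterm : ℕ → X → ℤ
  Φterm n x = + a n (proj₁ (g x)) τ * proj₂ (g x) y * (y - 1ℤ) ^ (n ∸ kParts (proj₁ (g x)))

  coeffX-map : ∀ xs → coeffX (map g xs) τ y ≡ ∑ (λ x → if proj₁ (g x) ==ₚ τ then proj₂ (g x) y else 0ℤ) xs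
  coeffX-map []       = refl
  coeffX-map (x ∷ xs) = cong (λ s → (if proj₁ (g x) ==ₚ τ then proj₂ (g x) y else 0ℤ) + s) (coeffX-map xs)

  ΦCoeff-map : ∀ n xs → ΦCoeff n (map g xs) τ y ≡ ∑ (Φterm n) xs
  ΦCoeff-map n []       = refl
  ΦCoeff-map n (x ∷ xs) = cong (λ s → Φterm n x + s) (ΦCoeff-map n xs)

module _ (G : Graph) (τ′ : IntPartition) (y : ℤ) where
  private
    N = n G
    E = edges G
    z = y - 1ℤ

  weight : List (Fin N × Fin N) → BRel N → ℤ
  weight A π = if isCoarseningᵇ (connected A) π ∧ (type π ==ₚ τ′) then z ^ length A else 0ℤ

  ∑-subsets-weight : ∀ π → IsPartition π →
                     ∑ (λ A → weight A π) (subsets E) ≡ (if type π ==ₚ τ′ then y ^ eInside G π else 0ℤ)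
  ∑-subsets-weight π isP with type π ==ₚ τ′
  ... | false = trans (∑-cong (λ A → cong (λ b → if b then z ^ length A else 0ℤ) (Bool.∧-zeroʳ _)) (subsets E))
                      (∑-zero (subsets E))
  ... | true  = trans (∑-cong (λ A → cong (λ b → if b then z ^ length A else 0ℤ)
                                         (trans (Bool.∧-identityʳ _) (connected-⊑ isP A))) (subsets E))
                      (∑-subsets y _ E)

  ∑-setPartitions-weight : ∀ A → ∑ (weight A) (setPartitions N)
                             ≡ + a N (compType G A) τ′ * z ^ (length A ∸ rank G A) * z ^ (N ∸ kParts (compType G A))
  ∑-setPartitions-weight A = begin
    ∑ (weight A) (setPartitions N)
      ≡⟨ ∑-if (λ π → isCoarseningᵇ R π ∧ (type π ==ₚ τ′)) (z ^ length A) (setPartitions N) ⟨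
    + coarseningCount R τ′ * z ^ length A
      ≡⟨ cong (λ k → + coarseningCount R τ′ * z ^ k) (ℕ.m∸n+n≡m r≤|A|) ⟨
    + coarseningCount R τ′ * z ^ (length A ∸ r ℕ.+ r)
      ≡⟨ cong (+ coarseningCount R τ′ *_) (ℤ.^-distribˡ-+-* z (length A ∸ r) r) ⟩
    + coarseningCount R τ′ * (z ^ (length A ∸ r) * z ^ r)
      ≡⟨ ℤ.*-assoc (+ coarseningCount R τ′) _ _ ⟨
    + coarseningCount R τ′ * z ^ (length A ∸ r) * z ^ r
      ≡⟨ cong₂ (λ c k → + c * z ^ (length A ∸ r) * z ^ k) (a-coarseningCount (connected-IsPartition A) τ′)
                                                        (cong (N ∸_) (kParts-type R)) ⟨
    + a N (type R) τ′ * z ^ (length A ∸ r) * z ^ (N ∸ kParts (type R)) ∎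
    where
      open ≡-Reasoning
      R = connected A
      r = N ∸ numBlocks R
      r≤|A| : r ≤ length A
      r≤|A| = ℕ.m≤n+o⇒m∸n≤o N (numBlocks R) (n≤numBlocks+length A)

-- The identity holds for every list τ′.
mainTheorem6 : (G : Graph) (τ' : IntPartition) → τ' ⊢ n G → (y : ℤ) →
    coeffX (χ G) τ' y ≡ ΦCoeff (n G) (U G) τ' y
mainTheorem6 G τ′ _ y = begin
  coeffX (χ G) τ′ y
    ≡⟨ coeffX-map _ τ′ y (setPartitions N) ⟩
  ∑ (λ π → if type π ==ₚ τ′ then y ^ eInside G π else 0ℤ) (setPartitions N)
    ≡⟨ ∑-filterᵇ-cong isEquivᵇ (λ π → sym ∘ ∑-subsets-weight G τ′ y π ∘ isEquivᵇ-sound π) (allBRels N) ⟩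
  ∑ (λ π → ∑ (λ A → weight G τ′ y A π) (subsets E)) (setPartitions N)
    ≡⟨ ∑-comm (weight G τ′ y) (subsets E) (setPartitions N) ⟨
  ∑ (λ A → ∑ (weight G τ′ y A) (setPartitions N)) (subsets E)
    ≡⟨ ∑-cong (∑-setPartitions-weight G τ′ y) (subsets E) ⟩
  ∑ (λ A → + a N (compType G A) τ′ * (y - 1ℤ) ^ (length A ∸ rank G A) * (y - 1ℤ) ^ (N ∸ kParts (compType G A)))
    (subsets E)
    ≡⟨ ΦCoeff-map _ τ′ y N (subsets E) ⟨
  ΦCoeff (n G) (U G) τ′ y ∎
  where
    open ≡-Reasoning
    N = n G
    E = edges G
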